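{- Let $t,r$ be integers with $\min\{t,r\}\ge 2$, and let $P_m$ denote the path on $m$ vertices. Then $$\chi_\mu(P_t\boxtimes P_r)=\begin{cases}1 & \text{if } t=r=2,\\ 2 & \text{if } t\ne r \text{ and } \min\{t,r\}=2,\\ \min\{\lceil t/2\rceil,\lceil r/2\rceil\} & \text{otherwise.}\end{cases}$$
   Context: All graphs are finite and simple. The strong product $G\boxtimes H$ has vertex set $V(G)\times V(H)$, with distinct $(g,h),(g',h')$ adjacent iff ($g=g'$ or $gg'\in E(G)$) and ($h=h'$ or $hh'\in E(H)$). A geodesic is a shortest path. For $X\subseteq V$, two vertices $x,y\in X$ are $X$-visible if some $x,y$-geodesic has no internal vertex in $X$; $X$ is a mutual-visibility (MV) set if every two of its vertices are $X$-visible. $\chi_\mu$ is the least $k$ such that the vertex set can be partitioned into $k$ MV sets. -}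

module Defs where

open import Level using (Level; suc; _⊔_; 0ℓ)
open import Data.Nat using (ℕ; zero; _+_; _≤_)
import Data.Nat as N
open import Data.Fin using (Fin; toℕ)
open import Data.Product using (Σ; _×_; _,_)
open import Data.Sum using (_⊎_)
open import Data.List using (List; []; _∷_)
open import Data.List.Relation.Unary.All using (All)
open import Relation.Nullary using (¬_)
open import Relation.Binary.PropositionalEquality using (_≡_)

record Graph : Set₁ where
  field
    V   : Set
    Adj : V → V → Set
open Graph public

PathGraph : ℕ → Graph
PathGraph m = record
  { V = Fin m
  ; Adj = λ i j → (N.suc (toℕ i) ≡ toℕ j) ⊎ (N.suc (toℕ j) ≡ toℕ i) }

_⊠_ : Graph → Graph → Graph
G ⊠ H = record
  { V = V G × V H
  ; Adj = λ { (g , h) (g' , h') →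
        ¬ ((g , h) ≡ (g' , h'))
      × ((g ≡ g') ⊎ Adj G g g')
      × ((h ≡ h') ⊎ Adj H h h') } }

module _ (G : Graph) where
  data Walk : V G → V G → Set where
    nil  : ∀ {x} → Walk x x
    step : ∀ {x y z} → Adj G x y → Walk y z → Walk x z

  len : ∀ {x y} → Walk x y → ℕ
  len nil = 0
  len (step _ w) = N.suc (len w)

  initVerts : ∀ {x y} → Walk x y → List (V G)
  initVerts nil = []
  initVerts (step {x = x} _ w) = x ∷ initVerts w

  internal : ∀ {x y} → Walk x y → List (V G)
  internal nil = []
  internal (step _ w) = initVerts w

  IsGeodesic : ∀ {x y} → Walk x y → Set
  IsGeodesic {x} {y} w = (w' : Walk x y) → len w ≤ len w'

  Visible : (X : V G → Set) → V G → V G → Set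
  Visible X x y =
    Σ (Walk x y) λ w → IsGeodesic w × All (λ v → ¬ X v) (internal w)

  IsMV : (V G → Set) → Set
  IsMV X = ∀ x y → X x → X y → Visible X x y

  -- partition of V into k MV sets (given by a colouring; empty classes
  -- are allowed, which does not change the minimum since ∅ is MV)
  MVPartition : ℕ → Set
  MVPartition k = Σ (V G → Fin k) λ c → (i : Fin k) → IsMV (λ v → c v ≡ i)

  IsChiMu : ℕ → Set
  IsChiMu k = MVPartition k × (∀ k' → MVPartition k' → k ≤ k')

{-# OPTIONS --safe #-}
-- In P_t ⊠ P_r the distance is the Chebyshev distance, and the walk that moves each coordinate one
-- step towards the target, keeping the row one short of the target row until the last step, is a
-- geodesic. Colour row a by a mod k, where k = ⌈t/2⌉ ⊓ ⌈r/2⌉ ≥ 2 and t ≤ 2k (otherwise use columns):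
-- a colour class is at most two rows, at distance at least 2, and between two of its rows that
-- geodesic stays strictly between them, while within one row it runs along a neighbouring row.
-- Conversely, every geodesic from (a, a) to (l, l) runs along the diagonal, so a class contains at
-- most two of the 2k + 1 vertices (0, 0), …, (2k, 2k), and k colours cannot suffice when 2k < t, r.
-- In the small cases P_2 ⊠ P_2 is complete, and two vertices at distance 2 force a second colour.
module Submission where

open import Function using (_∘_)
open import Data.Empty using (⊥; ⊥-elim)
open import Data.Unit using (⊤; tt)
open import Data.Nat
  using (ℕ; zero; suc; pred; _+_; _*_; _∸_; _⊓_; _⊔_; ∣_-_∣; ⌈_/2⌉; _≤_; _<_; z≤n; s≤s; NonZero; _≤?_)
open import Data.Nat.Properties
open import Data.Nat.DivMod using (_%_; _/_; _mod_; m≡m%n+[m/n]*n)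
open import Data.Fin using (Fin; zero; suc; toℕ; fromℕ<; inject₁; inject≤; join; splitAt)
  renaming (_<_ to _<ᶠ_)
open import Data.Fin.Properties
  using (toℕ<n; toℕ-injective; toℕ-fromℕ<; toℕ-inject₁; toℕ-inject≤; splitAt-join; pigeonhole; any?)
  renaming (_≟_ to _≟ᶠ_; _<?_ to _<ᶠ?_)
open import Data.Product using (Σ; ∃-syntax; _×_; _,_; proj₁; proj₂; swap)
open import Data.Product.Properties using (≡-dec)
open import Data.Sum using (_⊎_; inj₁; inj₂; [_,_])
import Data.Sum as Sum
import Data.Product as Product
open import Data.Sum.Properties using (inj₁-injective; inj₂-injective)
open import Data.List using ([]; _∷_; map)
open import Data.List.Membership.Propositional using (_∈_)
open import Data.List.Relation.Unary.All as All using (All; []; _∷_)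
open import Data.List.Relation.Unary.All.Properties using (map⁺)
open import Data.List.Relation.Unary.Any using (here; there)
open import Relation.Nullary using (¬_; Dec; yes; no; contradiction)
open import Relation.Nullary.Decidable using (_×-dec_)
open import Relation.Binary using (tri<; tri≈; tri>)
open import Relation.Binary.PropositionalEquality
  using (_≡_; _≢_; refl; sym; trans; cong; cong₂; subst; module ≡-Reasoning)

open import Defs

Close : (G : Graph) → V G → V G → Set
Close G x y = x ≡ y ⊎ Adj G x y

Lipschitz : (G : Graph) → (V G → ℕ) → Set
Lipschitz G f = ∀ {u v} → Adj G u v → ∣ f u - f v ∣ ≤ 1

module _ {G : Graph} where

  lipschitz⇒∣-∣≤len : ∀ f → Lipschitz G f → ∀ {x y} (w : Walk G x y) → ∣ f x - f y ∣ ≤ len G w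
  lipschitz⇒∣-∣≤len f _ {x} nil = ≤-reflexive (∣n-n∣≡0 (f x))
  lipschitz⇒∣-∣≤len f f-lip {x} {y} (step {y = z} x~z w) = begin
    ∣ f x - f y ∣                 ≤⟨ ∣-∣-triangle (f x) (f z) (f y) ⟩
    ∣ f x - f z ∣ + ∣ f z - f y ∣ ≤⟨ +-mono-≤ (f-lip x~z) (lipschitz⇒∣-∣≤len f f-lip w) ⟩
    1 + len G w                   ∎
    where open ≤-Reasoning

  ≢⇒1≤len : ∀ {x y} → x ≢ y → (w : Walk G x y) → 1 ≤ len G w
  ≢⇒1≤len x≢x nil = contradiction refl x≢x
  ≢⇒1≤len _ (step _ _) = s≤s z≤n

  source∈initVerts : ∀ {x y} → x ≢ y → (w : Walk G x y) → x ∈ initVerts G w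
  source∈initVerts x≢x nil = contradiction refl x≢x
  source∈initVerts _ (step _ _) = here refl

  internal⊆initVerts : ∀ {x y v} (w : Walk G x y) → v ∈ internal G w → v ∈ initVerts G w
  internal⊆initVerts (step _ _) v∈ = there v∈

  internal-nonempty : ∀ {x y} (w : Walk G x y) → 2 ≤ len G w → ∃[ v ] v ∈ internal G w
  internal-nonempty (step _ (step {x = v} _ _)) _ = v , here refl
  internal-nonempty (step _ nil) (s≤s ())

  Visible-refl : ∀ {X x} → Visible G X x x
  Visible-refl = nil , (λ _ → z≤n) , []

  Visible-adj : ∀ {X x y} → x ≢ y → Adj G x y → Visible G X x y
  Visible-adj x≢y x~y = step x~y nil , ≢⇒1≤len x≢y , []

  1≤parts : ∀ {k} → V G → MVPartition G k → 1 ≤ k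
  1≤parts {zero} v (c , _) with c v
  ... | ()
  1≤parts {suc _} _ _ = s≤s z≤n

  2≤parts : ∀ {k x y} → (∀ (w : Walk G x y) → 2 ≤ len G w) → MVPartition G k → 2 ≤ k
  2≤parts {zero} {x} _ P = contradiction (1≤parts x P) λ ()
  2≤parts {suc zero} {x} {y} far (c , mv) =
    let w , _ , avoids = mv zero x y (unique (c x)) (unique (c y))
        v , v∈ = internal-nonempty w (far w)
    in  ⊥-elim (All.lookup avoids v∈ (unique (c v)))
    where
    unique : (i : Fin 1) → i ≡ zero
    unique zero = refl
  2≤parts {suc (suc _)} _ _ = s≤s (s≤s z≤n)

  lipschitz-tight-step : ∀ f {x y z p q} → Lipschitz G f → (x~z : Adj G x z) (w : Walk G z y) →
                         f x ≡ p → f y ≡ q → p + len G (step x~z w) ≤ q → f z ≡ suc p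
  lipschitz-tight-step f {z = z} {p} f-lip x~z w refl refl tight = ≤-antisym upper lower
    where
    upper : f z ≤ suc p
    upper = ≤-trans (m≤n+∣n-m∣ (f z) p)
              (≤-trans (+-monoʳ-≤ p (f-lip x~z)) (≤-reflexive (+-comm p 1)))
    lower : suc p ≤ f z
    lower = +-cancelʳ-< _ p (f z)
      (<-≤-trans (+-monoʳ-< p (s≤s (lipschitz⇒∣-∣≤len f f-lip w)))
                 (≤-trans tight (m≤n+∣n-m∣ _ (f z))))

swapWalk : ∀ {G H x y} → Walk (G ⊠ H) x y → Walk (H ⊠ G) (swap x) (swap y)
swapWalk nil = nil
swapWalk (step (x≢z , g~ , h~) w) = step ((λ e → x≢z (cong swap e)) , h~ , g~) (swapWalk w)

len-swapWalk : ∀ {G H x y} (w : Walk (G ⊠ H) x y) → len (H ⊠ G) (swapWalk w) ≡ len (G ⊠ H) w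
len-swapWalk nil = refl
len-swapWalk (step _ w) = cong suc (len-swapWalk w)

module _ {G H : Graph} where

  initVerts-swapWalk : ∀ {x y} (w : Walk (G ⊠ H) x y) →
                       initVerts (H ⊠ G) (swapWalk w) ≡ map swap (initVerts (G ⊠ H) w)
  initVerts-swapWalk nil = refl
  initVerts-swapWalk (step _ w) = cong (_ ∷_) (initVerts-swapWalk w)

  internal-swapWalk : ∀ {x y} (w : Walk (G ⊠ H) x y) →
                      internal (H ⊠ G) (swapWalk w) ≡ map swap (internal (G ⊠ H) w)
  internal-swapWalk nil = refl
  internal-swapWalk (step _ w) = initVerts-swapWalk w

  swap-visible : ∀ {X x y} → Visible (G ⊠ H) X (swap x) (swap y) → Visible (H ⊠ G) (X ∘ swap) x y
  swap-visible (w , geodesic , avoids) =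
      swapWalk w
    , (λ w′ → subst (_≤ len (H ⊠ G) w′) (sym (len-swapWalk w))
                (≤-trans (geodesic (swapWalk w′)) (≤-reflexive (len-swapWalk w′))))
    , subst (All _) (sym (internal-swapWalk w)) (map⁺ avoids)

  swap-MVPartition : ∀ {k} → MVPartition (G ⊠ H) k → MVPartition (H ⊠ G) k
  swap-MVPartition (c , mv) = c ∘ swap , λ i x y cx cy → swap-visible (mv i (swap x) (swap y) cx cy)

∣n-1+n∣≡1 : ∀ n → ∣ n - suc n ∣ ≡ 1
∣n-1+n∣≡1 zero = refl
∣n-1+n∣≡1 (suc n) = ∣n-1+n∣≡1 n

∣-∣≤1⇒≡∨adjacent : ∀ a b → ∣ a - b ∣ ≤ 1 → a ≡ b ⊎ (suc a ≡ b ⊎ suc b ≡ a)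
∣-∣≤1⇒≡∨adjacent zero zero _ = inj₁ refl
∣-∣≤1⇒≡∨adjacent zero (suc zero) _ = inj₂ (inj₁ refl)
∣-∣≤1⇒≡∨adjacent zero (suc (suc _)) (s≤s ())
∣-∣≤1⇒≡∨adjacent (suc zero) zero _ = inj₂ (inj₂ refl)
∣-∣≤1⇒≡∨adjacent (suc (suc _)) zero (s≤s ())
∣-∣≤1⇒≡∨adjacent (suc a) (suc b) h =
  Sum.map (cong suc) (Sum.map (cong suc) (cong suc)) (∣-∣≤1⇒≡∨adjacent a b h)

≡∨adjacent⇒∣-∣≤1 : ∀ {a b} → a ≡ b ⊎ (suc a ≡ b ⊎ suc b ≡ a) → ∣ a - b ∣ ≤ 1
≡∨adjacent⇒∣-∣≤1 {a} (inj₁ refl) = ≤-trans (≤-reflexive (∣n-n∣≡0 a)) z≤n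
≡∨adjacent⇒∣-∣≤1 {a} (inj₂ (inj₁ refl)) = ≤-reflexive (∣n-1+n∣≡1 a)
≡∨adjacent⇒∣-∣≤1 {b = b} (inj₂ (inj₂ refl)) =
  ≤-reflexive (trans (∣-∣-comm (suc b) b) (∣n-1+n∣≡1 b))

-- One step from a towards b, except that it never lands on b: next to b it stays put.
approach : ℕ → ℕ → ℕ
approach zero zero = zero
approach zero (suc b) = 1 ⊓ b
approach (suc a) zero = suc (pred a)
approach (suc a) (suc b) = suc (approach a b)

approach-near : ∀ a b → ∣ a - approach a b ∣ ≤ 1
approach-near zero zero = z≤n
approach-near zero (suc zero) = z≤n
approach-near zero (suc (suc _)) = ≤-refl
approach-near (suc zero) zero = z≤n
approach-near (suc (suc a)) zero =
  ≤-reflexive (trans (∣-∣-comm (suc (suc a)) (suc a)) (∣n-1+n∣≡1 (suc a)))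
approach-near (suc a) (suc b) = approach-near a b

approach-closer : ∀ a b {n} → 2 ≤ n → ∣ a - b ∣ ≤ n → ∣ approach a b - b ∣ < n
approach-closer zero zero 2≤n _ = ≤-trans (s≤s z≤n) 2≤n
approach-closer zero (suc zero) 2≤n _ = 2≤n
approach-closer zero (suc (suc _)) _ h = h
approach-closer (suc zero) zero 2≤n _ = 2≤n
approach-closer (suc (suc _)) zero _ h = h
approach-closer (suc a) (suc b) 2≤n h = approach-closer a b 2≤n h

approach-neighbour : ∀ a b → ∣ a - b ∣ ≤ 1 → approach a b ≡ a
approach-neighbour zero zero _ = refl
approach-neighbour zero (suc zero) _ = refl
approach-neighbour zero (suc (suc _)) (s≤s ())
approach-neighbour (suc zero) zero _ = refl
approach-neighbour (suc (suc _)) zero (s≤s ())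
approach-neighbour (suc a) (suc b) h = cong suc (approach-neighbour a b h)

approach-ascending : ∀ {a b} → a < b → a ≤ approach a b × approach a b < b
approach-ascending {zero} {suc zero} _ = z≤n , s≤s z≤n
approach-ascending {zero} {suc (suc _)} _ = z≤n , s≤s (s≤s z≤n)
approach-ascending {suc a} {suc b} (s≤s a<b) = Product.map s≤s s≤s (approach-ascending a<b)

approach-descending : ∀ {a b} → b < a → b < approach a b × approach a b ≤ a
approach-descending {suc zero} {zero} _ = s≤s z≤n , ≤-refl
approach-descending {suc (suc a)} {zero} _ = s≤s z≤n , n≤1+n (suc a)
approach-descending {suc a} {suc b} (s≤s b<a) = Product.map s≤s s≤s (approach-descending b<a)

2+a≤b⇒approach≡1+a : ∀ {a b} → 2 + a ≤ b → approach a b ≡ suc a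
2+a≤b⇒approach≡1+a {zero} {suc (suc _)} _ = refl
2+a≤b⇒approach≡1+a {zero} {suc zero} (s≤s ())
2+a≤b⇒approach≡1+a {suc a} {suc b} (s≤s h) = cong suc (2+a≤b⇒approach≡1+a h)

2+b≤a⇒1+approach≡a : ∀ {a b} → 2 + b ≤ a → suc (approach a b) ≡ a
2+b≤a⇒1+approach≡a {suc (suc _)} {zero} _ = refl
2+b≤a⇒1+approach≡a {suc zero} {zero} (s≤s ())
2+b≤a⇒1+approach≡a {suc a} {suc b} (s≤s h) = cong suc (2+b≤a⇒1+approach≡a h)

approach≤⊔ : ∀ a b → approach a b ≤ a ⊔ b
approach≤⊔ zero zero = z≤n
approach≤⊔ zero (suc zero) = z≤n
approach≤⊔ zero (suc (suc _)) = s≤s z≤n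
approach≤⊔ (suc zero) zero = ≤-refl
approach≤⊔ (suc (suc a)) zero = n≤1+n (suc a)
approach≤⊔ (suc a) (suc b) = s≤s (approach≤⊔ a b)

StrictlyBetween : ℕ → ℕ → ℕ → Set
StrictlyBetween a v b = (a < v × v < b) ⊎ (b < v × v < a)

approach-enters-between : ∀ {a b} → 2 + a ≤ b ⊎ 2 + b ≤ a → StrictlyBetween a (approach a b) b
approach-enters-between {a} (inj₁ h) rewrite 2+a≤b⇒approach≡1+a h = inj₁ (n<1+n a , h)
approach-enters-between {a} {b} (inj₂ h) =
  inj₂ (≤-pred (subst (2 + b ≤_) (sym a≡) h) , ≤-reflexive a≡)
  where a≡ = 2+b≤a⇒1+approach≡a h

approach-stays-between : ∀ {a v b} → StrictlyBetween a v b → StrictlyBetween a (approach v b) b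
approach-stays-between (inj₁ (a<v , v<b)) =
  let v≤ , <b = approach-ascending v<b in inj₁ (<-≤-trans a<v v≤ , <b)
approach-stays-between (inj₂ (b<v , v<a)) =
  let b< , ≤v = approach-descending b<v in inj₂ (b< , ≤-<-trans ≤v v<a)

-- Sparse sets of rows

%≡%⇒/< : ∀ {m n k} .{{_ : NonZero k}} → m % k ≡ n % k → m < n → m / k < n / k
%≡%⇒/< {m} {n} {k} same m<n = ≰⇒> λ n/k≤m/k → <⇒≱ m<n (begin
  n                  ≡⟨ m≡m%n+[m/n]*n n k ⟩
  n % k + n / k * k  ≤⟨ +-monoʳ-≤ (n % k) (*-monoˡ-≤ k n/k≤m/k) ⟩
  n % k + m / k * k  ≡⟨ cong (_+ m / k * k) same ⟨
  m % k + m / k * k  ≡⟨ m≡m%n+[m/n]*n m k ⟨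
  m                  ∎)
  where open ≤-Reasoning

%≡%⇒+≤ : ∀ {m n k} .{{_ : NonZero k}} → m % k ≡ n % k → m < n → m + k ≤ n
%≡%⇒+≤ {m} {n} {k} same m<n = begin
  m + k                    ≡⟨ cong (_+ k) (m≡m%n+[m/n]*n m k) ⟩
  m % k + m / k * k + k    ≡⟨ +-assoc (m % k) _ k ⟩
  m % k + (m / k * k + k)  ≡⟨ cong₂ _+_ same (+-comm _ k) ⟩
  n % k + suc (m / k) * k  ≤⟨ +-monoʳ-≤ (n % k) (*-monoˡ-≤ k (%≡%⇒/< same m<n)) ⟩
  n % k + n / k * k        ≡⟨ m≡m%n+[m/n]*n n k ⟨
  n                        ∎
  where open ≤-Reasoning

record Sparse (t : ℕ) (S : ℕ → Set) : Set where
  field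
    nonconsecutive : ∀ {a} → S a → ¬ S (suc a)
    no-three       : ∀ {a b c} → a < b → b < c → c < t → S a → S b → S c → ⊥

  nonadjacent : ∀ {a b} → suc a ≡ b ⊎ suc b ≡ a → S a → ¬ S b
  nonadjacent (inj₁ refl) Sa = nonconsecutive Sa
  nonadjacent (inj₂ refl) Sa Sb = nonconsecutive Sb Sa

  far-apart : ∀ {a b} → S a → S b → a ≢ b → 2 + a ≤ b ⊎ 2 + b ≤ a
  far-apart {a} {b} Sa Sb a≢b with <-cmp a b
  ... | tri< a<b _ _ = inj₁ (≤∧≢⇒< a<b λ e → nonadjacent (inj₁ e) Sa Sb)
  ... | tri≈ _ a≡b _ = contradiction a≡b a≢b
  ... | tri> _ _ b<a = inj₂ (≤∧≢⇒< b<a λ e → nonadjacent (inj₂ e) Sa Sb)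

  between-excluded : ∀ {a b v} → a < t → b < t → S a → S b → StrictlyBetween a v b → ¬ S v
  between-excluded _ b<t Sa Sb (inj₁ (a<v , v<b)) Sv = no-three a<v v<b b<t Sa Sv Sb
  between-excluded a<t _ Sa Sb (inj₂ (b<v , v<a)) Sv = no-three b<v v<a a<t Sb Sv Sa

residue-classes-sparse : ∀ {t k} .{{_ : NonZero k}} → 2 ≤ k → t ≤ k + k → (i : Fin k) →
                         Sparse t (λ a → a mod k ≡ i)
residue-classes-sparse {t} {k} 2≤k t≤2k i = record
  { nonconsecutive = λ {a} Sa Sa+1 → <⇒≱ 2≤k
      (+-cancelˡ-≤ a k 1
        (≤-trans (%≡%⇒+≤ (same-residue Sa Sa+1) (n<1+n a)) (≤-reflexive (+-comm 1 a))))
  ; no-three = λ {a} {b} {c} a<b b<c c<t Sa Sb Sc → <⇒≱ (<-≤-trans c<t t≤2k) (begin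
      k + k        ≤⟨ m≤n+m (k + k) a ⟩
      a + (k + k)  ≡⟨ +-assoc a k k ⟨
      a + k + k    ≤⟨ +-monoˡ-≤ k (%≡%⇒+≤ (same-residue Sa Sb) a<b) ⟩
      b + k        ≤⟨ %≡%⇒+≤ (same-residue Sb Sc) b<c ⟩
      c            ∎)
  }
  where
  open ≤-Reasoning
  same-residue : ∀ {m n} → m mod k ≡ i → n mod k ≡ i → m % k ≡ n % k
  same-residue {m} {n} e e′ = begin-equality
    m % k             ≡⟨ toℕ-fromℕ< _ ⟨
    toℕ (m mod k)     ≡⟨ cong toℕ (trans e (sym e′)) ⟩
    toℕ (n mod k)     ≡⟨ toℕ-fromℕ< _ ⟩
    n % k             ∎

-- The strong product of two paths

close⇒∣-∣≤1 : ∀ {n} {i j : Fin n} → Close (PathGraph n) i j → ∣ toℕ i - toℕ j ∣ ≤ 1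
close⇒∣-∣≤1 = ≡∨adjacent⇒∣-∣≤1 ∘ Sum.map₁ (cong toℕ)

∣-∣≤1⇒close : ∀ {n} {i j : Fin n} → ∣ toℕ i - toℕ j ∣ ≤ 1 → Close (PathGraph n) i j
∣-∣≤1⇒close = Sum.map₁ toℕ-injective ∘ ∣-∣≤1⇒≡∨adjacent _ _

path-irreflexive : ∀ {n} {i : Fin n} → ¬ Adj (PathGraph n) i i
path-irreflexive = [ 1+n≢n , 1+n≢n ]

neighbour : ∀ {n} → 2 ≤ n → (i : Fin n) → ∃[ j ] Adj (PathGraph n) i j
neighbour (s≤s (s≤s _)) zero = suc zero , inj₁ refl
neighbour _ (suc i) = inject₁ i , inj₂ (cong suc (toℕ-inject₁ i))

approachFin : ∀ {n} → Fin n → Fin n → Fin n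
approachFin i j = fromℕ< (≤-<-trans (approach≤⊔ (toℕ i) (toℕ j)) (⊔-lub (toℕ<n i) (toℕ<n j)))

toℕ-approachFin : ∀ {n} (i j : Fin n) → toℕ (approachFin i j) ≡ approach (toℕ i) (toℕ j)
toℕ-approachFin i j = toℕ-fromℕ< _

approachFin-close : ∀ {n} (i j : Fin n) → Close (PathGraph n) i (approachFin i j)
approachFin-close i j = ∣-∣≤1⇒close
  (subst (λ a → ∣ toℕ i - a ∣ ≤ 1) (sym (toℕ-approachFin i j)) (approach-near (toℕ i) (toℕ j)))

approachFin-closer : ∀ {n m} (i j : Fin n) → 2 ≤ m → ∣ toℕ i - toℕ j ∣ ≤ m →
                     ∣ toℕ (approachFin i j) - toℕ j ∣ < m
approachFin-closer i j 2≤m h rewrite toℕ-approachFin i j = approach-closer (toℕ i) (toℕ j) 2≤m h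

King : ℕ → ℕ → Graph
King t r = PathGraph t ⊠ PathGraph r

module _ {t r : ℕ} where

  row col : V (King t r) → ℕ
  row = toℕ ∘ proj₁
  col = toℕ ∘ proj₂

  cheb : V (King t r) → V (King t r) → ℕ
  cheb x y = ∣ row x - row y ∣ ⊔ ∣ col x - col y ∣

  row-lipschitz : Lipschitz (King t r) row
  row-lipschitz (_ , rows , _) = close⇒∣-∣≤1 rows

  col-lipschitz : Lipschitz (King t r) col
  col-lipschitz (_ , _ , cols) = close⇒∣-∣≤1 cols

  cheb≤len : ∀ {x y} (w : Walk (King t r) x y) → cheb x y ≤ len (King t r) w
  cheb≤len w = ⊔-lub (lipschitz⇒∣-∣≤len row row-lipschitz w) (lipschitz⇒∣-∣≤len col col-lipschitz w)

  len≤cheb⇒geodesic : ∀ {x y} {w : Walk (King t r) x y} → len (King t r) w ≤ cheb x y →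
                      IsGeodesic (King t r) w
  len≤cheb⇒geodesic h w′ = ≤-trans h (cheb≤len w′)

  cheb≡0⇒≡ : ∀ {x y} → cheb x y ≡ 0 → x ≡ y
  cheb≡0⇒≡ {x} {y} e = cong₂ _,_ (coordinate (m≤m⊔n _ _)) (coordinate (m≤n⊔m _ _))
    where
    coordinate : ∀ {n} {i j : Fin n} → ∣ toℕ i - toℕ j ∣ ≤ cheb x y → i ≡ j
    coordinate h = toℕ-injective (∣m-n∣≡0⇒m≡n (n≤0⇒n≡0 (≤-trans h (≤-reflexive e))))

  cheb≤1⇒close : ∀ {x y} → cheb x y ≤ 1 → Close (King t r) x y
  cheb≤1⇒close {x} {y} h with ≡-dec _≟ᶠ_ _≟ᶠ_ x y
  ... | yes x≡y = inj₁ x≡y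
  ... | no x≢y =
    inj₂ (x≢y , ∣-∣≤1⇒close (≤-trans (m≤m⊔n _ _) h) , ∣-∣≤1⇒close (≤-trans (m≤n⊔m _ _) h))

  cheb≤1⇒visible : ∀ {X x y} → cheb x y ≤ 1 → Visible (King t r) X x y
  cheb≤1⇒visible {x = x} {y} h with cheb≤1⇒close {x} {y} h
  ... | inj₁ refl = Visible-refl
  ... | inj₂ x~y = Visible-adj (proj₁ x~y) x~y

  approachV : V (King t r) → V (King t r) → V (King t r)
  approachV (i , j) (i′ , j′) = approachFin i i′ , approachFin j j′

  approachV-closer : ∀ {x y} → 2 ≤ cheb x y → cheb (approachV x y) y < cheb x y
  approachV-closer {x} {y} far = ⊔-lub
    (approachFin-closer (proj₁ x) (proj₁ y) far (m≤m⊔n _ _))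
    (approachFin-closer (proj₂ x) (proj₂ y) far (m≤n⊔m _ _))

  approachV-adj : ∀ {x y} → 2 ≤ cheb x y → Adj (King t r) x (approachV x y)
  approachV-adj {x} {y} far =
      (λ x≡ → <-irrefl (cong (λ v → cheb v y) (sym x≡)) (approachV-closer {x} {y} far))
    , approachFin-close (proj₁ x) (proj₁ y)
    , approachFin-close (proj₂ x) (proj₂ y)

  ShortWalkInRows : (ℕ → Set) → V (King t r) → V (King t r) → Set
  ShortWalkInRows R x y =
    Σ (Walk (King t r) x y) λ w → len (King t r) w ≤ cheb x y × All (R ∘ row) (initVerts (King t r) w)

  greedyWalk : ∀ {x y} (R : ℕ → Set) → (∀ {a} → R a → R (approach a (row y))) → R (row x) →
               ShortWalkInRows R x y
  greedyWalk {x} {y} R R-closed Rx = go (cheb x y) ≤-refl Rx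
    where
    go : ∀ n {x} → cheb x y ≤ n → R (row x) → ShortWalkInRows R x y
    go n {x} _ Rx with cheb x y ≤? 1
    go n {x} _ Rx | yes near with cheb≤1⇒close {x} {y} near
    ... | inj₁ refl = nil , z≤n , []
    ... | inj₂ x~y = step x~y nil , n≢0⇒n>0 (proj₁ x~y ∘ cheb≡0⇒≡) , Rx ∷ []
    go zero h _ | no far = contradiction (≤-trans h z≤n) far
    go (suc n) {x} h Rx | no far =
      let far′ = ≰⇒> far
          closer = approachV-closer {x} {y} far′
          w , len-w , Rw = go n (≤-pred (≤-trans closer h))
                              (subst R (sym (toℕ-approachFin (proj₁ x) (proj₁ y))) (R-closed Rx))
      in  step (approachV-adj {x} {y} far′) w , ≤-trans (s≤s len-w) closer , Rx ∷ Rw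

  geodesic⇒len≤cheb : ∀ {x y} {w : Walk (King t r) x y} → IsGeodesic (King t r) w →
                      len (King t r) w ≤ cheb x y
  geodesic⇒len≤cheb {x} {y} geodesic =
    let w , len-w , _ = greedyWalk {x} {y} (λ _ → ⊤) (λ _ → tt) tt in ≤-trans (geodesic w) len-w

  visible-via-rows : ∀ {X x y z} (R : ℕ → Set) →
                     Adj (King t r) x z → cheb z y < cheb x y →
                     R (row z) → (∀ {a} → R a → R (approach a (row y))) →
                     (∀ {v} → R (row v) → ¬ X v) → Visible (King t r) X x y
  visible-via-rows {y = y} {z} R x~z closer Rz R-closed R⇒¬X =
    let w , len-w , Rw = greedyWalk {z} {y} R R-closed Rz
    in    step x~z w
        , len≤cheb⇒geodesic {w = step x~z w} (≤-trans (s≤s len-w) closer)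
        , All.map R⇒¬X Rw

  module _ {S : ℕ → Set} (sparse : Sparse t S) where
    open Sparse sparse

    within-row-visible : ∀ {x y} → 2 ≤ t → proj₁ x ≡ proj₁ y → 2 ≤ cheb x y → S (row x) →
                         Visible (King t r) (S ∘ row) x y
    within-row-visible {i , c} {.i , c′} 2≤t refl far Sx =
      visible-via-rows (_≡ toℕ j) x~z closer refl
        (λ { refl → approach-neighbour _ _ (close⇒∣-∣≤1 (inj₂ (Sum.swap i~j))) })
        (λ e → nonadjacent i~j Sx ∘ subst S e)
      where
      j = proj₁ (neighbour 2≤t i)
      i~j = proj₂ (neighbour 2≤t i)
      x~z : Adj (King t r) (i , c) (j , approachFin c c′)
      x~z = (λ e → path-irreflexive (subst (Adj (PathGraph t) i) (sym (cong proj₁ e)) i~j))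
          , inj₂ i~j , approachFin-close c c′
      closer : cheb (j , approachFin c c′) (i , c′) < cheb (i , c) (i , c′)
      closer = ⊔-lub (≤-trans (s≤s (close⇒∣-∣≤1 (inj₂ (Sum.swap i~j)))) far)
                     (approachFin-closer c c′ far (m≤n⊔m _ _))

    across-rows-visible : ∀ {x y} → proj₁ x ≢ proj₁ y → 2 ≤ cheb x y → S (row x) → S (row y) →
                          Visible (King t r) (S ∘ row) x y
    across-rows-visible {x} {y} x≢y far Sx Sy =
      visible-via-rows Inside (approachV-adj {x} {y} far) (approachV-closer {x} {y} far)
        (subst Inside (sym (toℕ-approachFin (proj₁ x) (proj₁ y)))
          (approach-enters-between (far-apart Sx Sy (x≢y ∘ toℕ-injective))))
        approach-stays-between
        (between-excluded (toℕ<n (proj₁ x)) (toℕ<n (proj₁ y)) Sx Sy)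
      where
      Inside = λ v → StrictlyBetween (row x) v (row y)

    sparse⇒MV : 2 ≤ t → IsMV (King t r) (S ∘ row)
    sparse⇒MV 2≤t x y Sx Sy with cheb x y ≤? 1 | proj₁ x ≟ᶠ proj₁ y
    ... | yes near | _ = cheb≤1⇒visible near
    ... | no far | yes same-row = within-row-visible 2≤t same-row (≰⇒> far) Sx
    ... | no far | no other-row = across-rows-visible other-row (≰⇒> far) Sx Sy

  OnDiagonal : ℕ → V (King t r) → Set
  OnDiagonal p v = row v ≡ p × col v ≡ p

  on-diagonal-unique : ∀ {p u v} → OnDiagonal p u → OnDiagonal p v → u ≡ v
  on-diagonal-unique (ru , cu) (rv , cv) =
    cong₂ _,_ (toℕ-injective (trans ru (sym rv))) (toℕ-injective (trans cu (sym cv)))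

  diagonal-step : ∀ {p q x y z} (x~z : Adj (King t r) x z) (w : Walk (King t r) z y) →
                  OnDiagonal p x → OnDiagonal q y → p + len (King t r) (step x~z w) ≤ q →
                  OnDiagonal (suc p) z
  diagonal-step x~z w (rx , cx) (ry , cy) tight =
      lipschitz-tight-step row row-lipschitz x~z w rx ry tight
    , lipschitz-tight-step col col-lipschitz x~z w cx cy tight

  diagonal∈internal : ∀ {p q b x y v} (w : Walk (King t r) x y) → OnDiagonal p x → OnDiagonal q y →
                      p + len (King t r) w ≤ q → p < b → b < q → OnDiagonal b v →
                      v ∈ internal (King t r) w
  diagonal∈internal nil (refl , _) (x≡q , _) _ p<b b<q _ = contradiction (<-trans p<b b<q) (<-irrefl x≡q)
  diagonal∈internal {p} {q} {b} (step x~z w) x-diag y-diag tight p<b b<q v-diag with b ≟ suc p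
  ... | yes refl =
    subst (_∈ initVerts (King t r) w) (on-diagonal-unique z-diag v-diag) (source∈initVerts z≢y w)
    where
    z-diag = diagonal-step x~z w x-diag y-diag tight
    z≢y = λ z≡y → <-irrefl (trans (sym (proj₁ z-diag)) (trans (cong row z≡y) (proj₁ y-diag))) b<q
  ... | no b≢1+p = internal⊆initVerts w
    (diagonal∈internal w (diagonal-step x~z w x-diag y-diag tight) y-diag
       (subst (_≤ q) (+-suc p _) tight) (≤∧≢⇒< p<b (b≢1+p ∘ sym)) b<q v-diag)

  cheb-diagonal : ∀ {p q x y} → OnDiagonal p x → OnDiagonal q y → cheb x y ≡ ∣ p - q ∣
  cheb-diagonal (rx , cx) (ry , cy) =
    trans (cong₂ _⊔_ (cong₂ ∣_-_∣ rx ry) (cong₂ ∣_-_∣ cx cy)) (⊔-idem _)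

  geodesic-along-diagonal : ∀ {p q x y} {w : Walk (King t r) x y} → OnDiagonal p x → OnDiagonal q y →
                            p ≤ q → IsGeodesic (King t r) w → p + len (King t r) w ≤ q
  geodesic-along-diagonal {p} {q} {x} {y} {w} x-diag y-diag p≤q geodesic = begin
    p + len (King t r) w  ≤⟨ +-monoʳ-≤ p (geodesic⇒len≤cheb {x} {y} {w} geodesic) ⟩
    p + cheb x y          ≡⟨ cong (p +_) (trans (cheb-diagonal x-diag y-diag) (m≤n⇒∣m-n∣≡n∸m p≤q)) ⟩
    p + (q ∸ p)           ≡⟨ m+[n∸m]≡n p≤q ⟩
    q                     ∎
    where open ≤-Reasoning

-- The diagonal lower bound

n≤⌈n/2⌉+⌈n/2⌉ : ∀ n → n ≤ ⌈ n /2⌉ + ⌈ n /2⌉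
n≤⌈n/2⌉+⌈n/2⌉ n =
  subst (_≤ ⌈ n /2⌉ + ⌈ n /2⌉) (⌊n/2⌋+⌈n/2⌉≡n n) (+-monoˡ-≤ ⌈ n /2⌉ (⌊n/2⌋≤⌈n/2⌉ n))

<⌈n/2⌉⇒+<n : ∀ {k n} → k < ⌈ n /2⌉ → k + k < n
<⌈n/2⌉⇒+<n {k} k<⌈n/2⌉ = ≰⇒> λ n≤k+k →
  <⇒≱ k<⌈n/2⌉ (≤-trans (⌈n/2⌉-mono n≤k+k) (≤-reflexive (sym (n≡⌈n+n/2⌉ k))))

module _ {k : ℕ} (f : Fin (suc (k + k)) → Fin k) where

  MonochromaticTriple : Set
  MonochromaticTriple = ∃[ a ] ∃[ b ] ∃[ c ] a <ᶠ b × b <ᶠ c × f a ≡ f b × f b ≡ f c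

  private
    Repeated : Fin (suc (k + k)) → Set
    Repeated i = ∃[ j ] j <ᶠ i × f j ≡ f i

    repeated? : ∀ i → Dec (Repeated i)
    repeated? i = any? λ j → (j <ᶠ? i) ×-dec (f j ≟ᶠ f i)

    tag : ∀ i → Dec (Repeated i) → Fin k ⊎ Fin k
    tag i (yes _) = inj₂ (f i)
    tag i (no _) = inj₁ (f i)

    collision : ∀ {i j} → i <ᶠ j → (di : Dec (Repeated i)) (dj : Dec (Repeated j)) →
                tag i di ≡ tag j dj → MonochromaticTriple
    collision i<j (yes (h , h<i , fh≡fi)) (yes _) same =
      h , _ , _ , h<i , i<j , fh≡fi , inj₂-injective same
    collision {i} i<j (no _) (no ¬repeated) same = contradiction (i , i<j , inj₁-injective same) ¬repeated

  -- Tag each point by its colour and by whether that colour occurred before; 2k tags for 2k + 1 points.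
  pigeonhole₃ : MonochromaticTriple
  pigeonhole₃ with pigeonhole (n<1+n (k + k)) (λ i → join k k (tag i (repeated? i)))
  ... | i , j , i<j , same = collision i<j (repeated? i) (repeated? j) (begin
    tag i (repeated? i)                          ≡⟨ splitAt-join k k _ ⟨
    splitAt k (join k k (tag i (repeated? i)))   ≡⟨ cong (splitAt k) same ⟩
    splitAt k (join k k (tag j (repeated? j)))   ≡⟨ splitAt-join k k _ ⟩
    tag j (repeated? j)                          ∎)
    where open ≡-Reasoning

module _ {t r : ℕ} where

  long-diagonal⇒¬MVPartition : ∀ {k} → suc (k + k) ≤ t → suc (k + k) ≤ r → ¬ MVPartition (King t r) k
  long-diagonal⇒¬MVPartition {k} 2k<t 2k<r (c , mv) =
    let a , b , l , a<b , b<l , ca≡cb , cb≡cl = pigeonhole₃ (c ∘ diagonal)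
        w , geodesic , avoids = mv (c (diagonal b)) (diagonal a) (diagonal l) ca≡cb (sym cb≡cl)
        tight = geodesic-along-diagonal (on a) (on l) (<⇒≤ (<-trans a<b b<l)) geodesic
    in  All.lookup avoids (diagonal∈internal w (on a) (on l) tight a<b b<l (on b)) refl
    where
    diagonal : Fin (suc (k + k)) → V (King t r)
    diagonal i = inject≤ i 2k<t , inject≤ i 2k<r
    on : ∀ i → OnDiagonal (toℕ i) (diagonal i)
    on i = toℕ-inject≤ i 2k<t , toℕ-inject≤ i 2k<r

  diagonal-lower-bound : ∀ {k} → MVPartition (King t r) k → ⌈ t /2⌉ ⊓ ⌈ r /2⌉ ≤ k
  diagonal-lower-bound P = ≮⇒≥ λ k<min → long-diagonal⇒¬MVPartition
    (<⌈n/2⌉⇒+<n (<-≤-trans k<min (m⊓n≤m _ _)))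
    (<⌈n/2⌉⇒+<n (<-≤-trans k<min (m⊓n≤n _ _)))
    P

3≤side⇒2≤parts : ∀ {t r k} → 2 ≤ t → 2 ≤ r → 3 ≤ t ⊎ 3 ≤ r → MVPartition (King t r) k → 2 ≤ k
3≤side⇒2≤parts _ (s≤s _) (inj₁ (s≤s (s≤s (s≤s _)))) =
  2≤parts {x = zero , zero} {y = suc (suc zero) , zero} cheb≤len
3≤side⇒2≤parts (s≤s _) _ (inj₂ (s≤s (s≤s (s≤s _)))) =
  2≤parts {x = zero , zero} {y = zero , suc (suc zero)} cheb≤len

King₂₂-partition : MVPartition (King 2 2) 1
King₂₂-partition = (λ _ → zero) , λ _ x y _ _ →
  cheb≤1⇒visible (⊔-lub (binary (proj₁ x) (proj₁ y)) (binary (proj₂ x) (proj₂ y)))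
  where
  binary : (i j : Fin 2) → ∣ toℕ i - toℕ j ∣ ≤ 1
  binary i j = ≤-trans (∣m-n∣≤m⊔n (toℕ i) (toℕ j)) (≤-pred (⊔-lub (toℕ<n i) (toℕ<n j)))

row-partition : ∀ {t r k} → 2 ≤ t → 2 ≤ k → ⌈ t /2⌉ ≤ k → MVPartition (King t r) k
row-partition {t} {k = k@(suc _)} 2≤t 2≤k ⌈t/2⌉≤k =
  (λ v → row v mod k) , λ i → sparse⇒MV (residue-classes-sparse 2≤k t≤2k i) 2≤t
  where
  t≤2k = ≤-trans (n≤⌈n/2⌉+⌈n/2⌉ t) (+-mono-≤ ⌈t/2⌉≤k ⌈t/2⌉≤k)

upper-bound : ∀ {t r k} → 2 ≤ t → 2 ≤ r → 2 ≤ k → ⌈ t /2⌉ ≤ k ⊎ ⌈ r /2⌉ ≤ k → MVPartition (King t r) k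
upper-bound 2≤t _ 2≤k (inj₁ ⌈t/2⌉≤k) = row-partition 2≤t 2≤k ⌈t/2⌉≤k
upper-bound _ 2≤r 2≤k (inj₂ ⌈r/2⌉≤k) = swap-MVPartition (row-partition 2≤r 2≤k ⌈r/2⌉≤k)

⊓≡⇒≡ : ∀ {m n o} → m ⊓ n ≡ o → m ≡ o ⊎ n ≡ o
⊓≡⇒≡ {m} {n} m⊓n≡o = Sum.map (λ e → trans (sym e) m⊓n≡o) (λ e → trans (sym e) m⊓n≡o) (⊓-sel m n)

≢⇒3≤ : ∀ {t r} → 2 ≤ t → 2 ≤ r → t ≢ r → 3 ≤ t ⊎ 3 ≤ r
≢⇒3≤ {t} 2≤t 2≤r t≢r with 2 ≟ t
... | yes refl = inj₂ (≤∧≢⇒< 2≤r t≢r)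
... | no 2≢t = inj₁ (≤∧≢⇒< 2≤t 2≢t)

3≤-unless-special : ∀ {t r} → 2 ≤ t → 2 ≤ r → ¬ (t ≡ 2 × r ≡ 2) → ¬ (t ≢ r × t ⊓ r ≡ 2) → 3 ≤ t
3≤-unless-special {t} {r} 2≤t 2≤r ¬square ¬thin with 2 ≟ t | r ≟ 2
... | no 2≢t | _ = ≤∧≢⇒< 2≤t 2≢t
... | yes refl | yes r≡2 = contradiction (refl , r≡2) ¬square
... | yes refl | no r≢2 = contradiction ((r≢2 ∘ sym) , m≤n⇒m⊓n≡m 2≤r) ¬thin

theorem5p7 : (t r : ℕ) → 2 ≤ t → 2 ≤ r →
    ((t ≡ 2 × r ≡ 2) → IsChiMu (PathGraph t ⊠ PathGraph r) 1)
    × ((t ≢ r × t ⊓ r ≡ 2) → IsChiMu (PathGraph t ⊠ PathGraph r) 2)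
    × ((¬ (t ≡ 2 × r ≡ 2) × ¬ (t ≢ r × t ⊓ r ≡ 2)) →
       IsChiMu (PathGraph t ⊠ PathGraph r) (⌈ t /2⌉ ⊓ ⌈ r /2⌉))
theorem5p7 t r 2≤t 2≤r = square , thin , thick
  where
  square : t ≡ 2 × r ≡ 2 → IsChiMu (King t r) 1
  square (refl , refl) = King₂₂-partition , λ _ → 1≤parts (zero , zero)

  thin : t ≢ r × t ⊓ r ≡ 2 → IsChiMu (King t r) 2
  thin (t≢r , t⊓r≡2) =
      upper-bound 2≤t 2≤r ≤-refl (Sum.map ⌈/2⌉≤2 ⌈/2⌉≤2 (⊓≡⇒≡ t⊓r≡2))
    , λ _ → 3≤side⇒2≤parts 2≤t 2≤r (≢⇒3≤ 2≤t 2≤r t≢r)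
    where
    ⌈/2⌉≤2 : ∀ {n} → n ≡ 2 → ⌈ n /2⌉ ≤ 2
    ⌈/2⌉≤2 refl = s≤s z≤n

  thick : ¬ (t ≡ 2 × r ≡ 2) × ¬ (t ≢ r × t ⊓ r ≡ 2) → IsChiMu (King t r) (⌈ t /2⌉ ⊓ ⌈ r /2⌉)
  thick (¬square , ¬thin) =
      upper-bound 2≤t 2≤r (⊓-glb (⌈n/2⌉-mono 3≤t) (⌈n/2⌉-mono 3≤r))
          (Sum.map (≤-reflexive ∘ sym) (≤-reflexive ∘ sym) (⊓-sel ⌈ t /2⌉ ⌈ r /2⌉))
    , λ _ → diagonal-lower-bound
    where
    3≤t = 3≤-unless-special 2≤t 2≤r ¬square ¬thin
    3≤r = 3≤-unless-special 2≤r 2≤t (¬square ∘ swap)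
            λ (r≢t , r⊓t≡2) → ¬thin (r≢t ∘ sym , trans (⊓-comm t r) r⊓t≡2)
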